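{- If $G$ is a finite, connected, $d$-regular simple graph with diameter at least $3$, then \[\min_{v,r}\delta(\overline{\mathcal{L}}_r(v))\leq\left\lfloor (2d-1)/3\right\rfloor,\] where the minimum is over all vertices $v$ of $G$ and all integers $r\ge 1$. Moreover, for every $d\equiv 2\pmod 3$ and every $D\ge 3$ there exists a finite, connected, $d$-regular graph of diameter at least $D$ for which equality holds.
   Context: For a graph $G$, a vertex $v$ and an integer $r\ge 1$, the ball $\mathcal{B}_r(v)=\{w\in V(G): d(v,w)\le r\}$ is the set of vertices at graph distance at most $r$ from $v$, and $\overline{\mathcal{L}}_r(v)=G[\mathcal{B}_r(v)]$ is the subgraph induced by it. $\delta(H)$ denotes the minimum degree of a graph $H$. -}

module Defs where

open import Data.Nat using (ℕ; zero; suc; _⊓_)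
open import Data.Bool using (Bool; true; false; _∧_; _∨_; T)
open import Data.Fin using (Fin; _≟_)
open import Data.List using (List; length; filterᵇ; foldr; map; allFin)
open import Data.Bool.ListAction using (any)
open import Data.Empty using (⊥)
open import Data.Product using (Σ; ∃; _×_)
open import Relation.Binary.PropositionalEquality using (_≡_)
open import Relation.Nullary.Decidable using (⌊_⌋)

record Graph : Set where
  field
    n      : ℕ
    adj    : Fin n → Fin n → Bool
    sym    : ∀ u v → adj u v ≡ adj v u
    irrefl : ∀ v → adj v v ≡ false
open Graph public

count : ∀ {m} → (Fin m → Bool) → ℕ
count {m} P = length (filterᵇ P (allFin m))

deg : (G : Graph) → Fin (n G) → ℕ
deg G w = count (adj G w)

-- inBall G v r w = true  iff  d(v,w) ≤ r  (there is a walk of length ≤ r from v to w)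
inBall : (G : Graph) → Fin (n G) → ℕ → Fin (n G) → Bool
inBall G v zero    w = ⌊ v ≟ w ⌋
inBall G v (suc r) w = inBall G v r w ∨ any (λ u → inBall G v r u ∧ adj G u w) (allFin (n G))

DistLe : (G : Graph) → Fin (n G) → Fin (n G) → ℕ → Set
DistLe G u v r = T (inBall G u r v)

-- degree of w in the induced subgraph  L̄_r(v) = G[B_r(v)]
degBall : (G : Graph) → Fin (n G) → ℕ → Fin (n G) → ℕ
degBall G v r w = count (λ u → adj G w u ∧ inBall G v r u)

-- δ(L̄_r(v)) : minimum degree of the induced subgraph on the ball
-- (the ball is nonempty since it contains v, so we start the fold at deg of v)
δBall : (G : Graph) → Fin (n G) → ℕ → ℕ
δBall G v r =
  foldr _⊓_ (degBall G v r v)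
    (map (degBall G v r) (filterᵇ (inBall G v r) (allFin (n G))))

Connected : Graph → Set
Connected G = ∀ u v → ∃ λ r → DistLe G u v r

Regular : Graph → ℕ → Set
Regular G d = ∀ v → deg G v ≡ d

-- diameter ≥ D : some pair of vertices is at distance ≥ D, i.e. not at distance ≤ D - 1
DiamAtLeast : Graph → ℕ → Set
DiamAtLeast G zero    = Fin (n G)
DiamAtLeast G (suc D) = Σ (Fin (n G)) λ u → Σ (Fin (n G)) λ v → (DistLe G u v D → ⊥)

Fin′ : Graph → Set
Fin′ G = Fin (n G)

module Submission where

-- Upper bound: pick a path u ∼ a ∼ b ∼ v with d(u, v) = 3 and look at the radius-1 balls
-- around a, v and u.  There b has at most |N(b) ∩ N[a] ∩ N[v]| + |N(b) ∖ N[v]| neighbours,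
-- resp. |N(b) ∩ N[v]|, and a has |N(a) ∩ N[u]|.  As N[u] and N[v] are disjoint, the set
-- N(b) ∩ N[a] ∩ N[v] together with b lies in N(a) ∖ N[u]; so the three minimum degrees add
-- up to at most 2d − 1 and one of them is at most ⌊(2d − 1)/3⌋.
--
-- Sharpness: for d = 3k + 2 replace every vertex of the cycle C_{2D′+2} by a clique of size
-- k + 1 and join cliques of adjacent cycle vertices completely.  If w lies in a ball of
-- radius r + 1, then some p with d(p, w) ≤ 1 lies in the ball of radius r, so the clique of w
-- and a clique adjacent to both w and p lie in the ball: w keeps 2k + 1 = ⌊(2d − 1)/3⌋
-- neighbours.  In the radius-1 ball around a vertex of group 0, a vertex of group 1 keeps
-- exactly that many.

open import Defs
open import Data.Bool using (Bool; true; false; _∧_; _∨_; not; T; if_then_else_)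
open import Data.Bool.Properties using (T-∧; T-∨; T-≡; T?; ∧-comm)
open import Data.Empty using (⊥-elim)
open import Data.Unit using (tt)
open import Data.Fin using (Fin; zero; suc; toℕ; fromℕ<; _↑ˡ_; _↑ʳ_; quotient; combine) renaming (_≟_ to _≟ᶠ_)
open import Data.Fin.Properties using (toℕ<n; toℕ-injective; toℕ-fromℕ<; splitAt-↑ˡ; splitAt-↑ʳ; remQuot-combine)
open import Data.List using (length; filterᵇ; foldr; map; allFin; tabulate)
open import Data.List.Membership.Propositional using (_∈_; lose)
open import Data.List.Membership.Propositional.Properties using (∈-allFin; ∈-map⁺; ∈-filter⁺)
open import Data.List.Properties using (foldr-preservesᵇ)
import Data.List.Relation.Unary.All as All
import Data.List.Relation.Unary.All.Properties as All
open import Data.List.Relation.Unary.Any using (here; there; satisfied)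
open import Data.List.Relation.Unary.Any.Properties using (any⁺; any⁻)
open import Data.Nat using (ℕ; zero; suc; _+_; _*_; _∸_; _/_; _%_; _≤_; _<_; _⊓_; _≡ᵇ_; z≤n; s≤s; s≤s⁻¹) renaming (_≟_ to _≟ℕ_)
open import Data.Nat.Properties
open import Data.Nat.DivMod using (m≡m%n+[m/n]*n; m*n/n≡m; /-monoˡ-≤)
open import Data.Nat.Tactic.RingSolver using (solve-∀)
open import Data.Product using (Σ; ∃-syntax; _×_; _,_; proj₁; proj₂)
open import Data.Sum using (_⊎_; inj₁; inj₂; [_,_]; swap)
open import Function using (_∘_; id; Equivalence)
open import Relation.Binary.PropositionalEquality using (_≡_; _≢_; refl; cong; cong₂; trans; subst; subst₂; module ≡-Reasoning)
import Relation.Binary.PropositionalEquality as ≡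
open import Relation.Nullary using (¬_; Dec; yes; no; contradiction)
open import Relation.Nullary.Decidable using (⌊_⌋; toWitness; fromWitness)

∧-intro : ∀ {x y} → T x → T y → T (x ∧ y)
∧-intro tx ty = Equivalence.from T-∧ (tx , ty)

∧-elimˡ : ∀ {x y} → T (x ∧ y) → T x
∧-elimˡ {x} {y} = proj₁ ∘ Equivalence.to (T-∧ {x} {y})

∧-elimʳ : ∀ {x y} → T (x ∧ y) → T y
∧-elimʳ {x} {y} = proj₂ ∘ Equivalence.to (T-∧ {x} {y})

∨-elim : ∀ {x y} → T (x ∨ y) → T x ⊎ T y
∨-elim {x} {y} = Equivalence.to (T-∨ {x} {y})

∨-introˡ : ∀ {x y} → T x → T (x ∨ y)
∨-introˡ {x} {y} = Equivalence.from (T-∨ {x} {y}) ∘ inj₁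

∨-introʳ : ∀ {x y} → T y → T (x ∨ y)
∨-introʳ {x} {y} = Equivalence.from (T-∨ {x} {y}) ∘ inj₂

not-intro : ∀ {x} → ¬ T x → T (not x)
not-intro {true}  ¬tx = ¬tx tt
not-intro {false} _   = tt

T-extensional : ∀ {x y} → (T x → T y) → (T y → T x) → x ≡ y
T-extensional {true}  {true}  _ _ = refl
T-extensional {true}  {false} f _ = ⊥-elim (f _)
T-extensional {false} {true}  _ g = ⊥-elim (g _)
T-extensional {false} {false} _ _ = refl

≟ᶠ-sym : ∀ {m} (x y : Fin m) → ⌊ x ≟ᶠ y ⌋ ≡ ⌊ y ≟ᶠ x ⌋
≟ᶠ-sym x y = T-extensional (fromWitness ∘ ≡.sym ∘ toWitness) (fromWitness ∘ ≡.sym ∘ toWitness)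

≟ᶠ-refl : ∀ {m} (x : Fin m) → ⌊ x ≟ᶠ x ⌋ ≡ true
≟ᶠ-refl x = Equivalence.to T-≡ (fromWitness {a? = x ≟ᶠ x} refl)

-- Counting

-- `count` recomputed by recursion on the domain, so that counting arguments go by induction.
# : ∀ {m} → (Fin m → Bool) → ℕ
# {zero}  P = 0
# {suc m} P = if P zero then suc (# (P ∘ suc)) else # (P ∘ suc)

count-tabulate : ∀ {k m} (P : Fin k → Bool) (f : Fin m → Fin k) →
                 length (filterᵇ P (tabulate f)) ≡ # (P ∘ f)
count-tabulate {m = zero}  P f = refl
count-tabulate {m = suc m} P f with P (f zero)
... | true  = cong suc (count-tabulate P (f ∘ suc))
... | false = count-tabulate P (f ∘ suc)

count≡# : ∀ {m} (P : Fin m → Bool) → count P ≡ # P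
count≡# P = count-tabulate P id

#-mono : ∀ {m} (P Q : Fin m → Bool) → (∀ i → T (P i) → T (Q i)) → # P ≤ # Q
#-mono {zero}  P Q P⊆Q = z≤n
#-mono {suc m} P Q P⊆Q with P zero | Q zero | P⊆Q zero
... | true  | true  | _ = s≤s (#-mono (P ∘ suc) (Q ∘ suc) (P⊆Q ∘ suc))
... | true  | false | f = ⊥-elim (f tt)
... | false | true  | _ = m≤n⇒m≤1+n (#-mono (P ∘ suc) (Q ∘ suc) (P⊆Q ∘ suc))
... | false | false | _ = #-mono (P ∘ suc) (Q ∘ suc) (P⊆Q ∘ suc)

#-cong : ∀ {m} (P Q : Fin m → Bool) → (∀ i → T (P i) → T (Q i)) → (∀ i → T (Q i) → T (P i)) →
         # P ≡ # Q
#-cong P Q P⊆Q Q⊆P = ≤-antisym (#-mono P Q P⊆Q) (#-mono Q P Q⊆P)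

#-ext : ∀ {m} {P Q : Fin m → Bool} → (∀ i → P i ≡ Q i) → # P ≡ # Q
#-ext {zero}  P≡Q = refl
#-ext {suc m} P≡Q rewrite P≡Q zero = cong (λ c → if _ then suc c else c) (#-ext (P≡Q ∘ suc))

#-partition : ∀ {m} (P Q : Fin m → Bool) →
              # P ≡ # (λ i → P i ∧ Q i) + # (λ i → P i ∧ not (Q i))
#-partition {zero}  P Q = refl
#-partition {suc m} P Q with P zero | Q zero | #-partition (P ∘ suc) (Q ∘ suc)
... | true  | true  | e = cong suc e
... | true  | false | e = trans (cong suc e) (≡.sym (+-suc _ _))
... | false | _     | e = e

#-∨ : ∀ {m} (P Q : Fin m → Bool) → (∀ i → T (P i) → ¬ T (Q i)) →
      # (λ i → P i ∨ Q i) ≡ # P + # Q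
#-∨ {zero}  P Q _ = refl
#-∨ {suc m} P Q disj with P zero | Q zero | disj zero | #-∨ (P ∘ suc) (Q ∘ suc) (disj ∘ suc)
... | true  | true  | f | _ = ⊥-elim (f tt tt)
... | true  | false | _ | e = cong suc e
... | false | true  | _ | e = trans (cong suc e) (≡.sym (+-suc _ _))
... | false | false | _ | e = e

#-toℕ≡ : ∀ {m} c → c < m → # (λ (j : Fin m) → toℕ j ≡ᵇ c) ≡ 1
#-toℕ≡ {suc m} zero    _         = cong suc (#-none m)
  where
  #-none : ∀ m → # (λ (j : Fin m) → toℕ (suc j) ≡ᵇ 0) ≡ 0
  #-none zero    = refl
  #-none (suc m) = #-none m
#-toℕ≡ {suc m} (suc c) (s≤s c<m) = #-toℕ≡ c c<m

#-single : ∀ {m} (w : Fin m) → # (λ u → ⌊ w ≟ᶠ u ⌋) ≡ 1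
#-single {m} w = trans (#-cong _ _ to from) (#-toℕ≡ (toℕ w) (toℕ<n w))
  where
  to : ∀ u → T ⌊ w ≟ᶠ u ⌋ → T (toℕ u ≡ᵇ toℕ w)
  to u t = ≡⇒≡ᵇ _ _ (cong toℕ (≡.sym (toWitness t)))
  from : ∀ u → T (toℕ u ≡ᵇ toℕ w) → T ⌊ w ≟ᶠ u ⌋
  from u t = fromWitness (≡.sym (toℕ-injective (≡ᵇ⇒≡ _ _ t)))

#-pair : ∀ {m} {a c : Fin m} → a ≢ c → # (λ j → ⌊ a ≟ᶠ j ⌋ ∨ ⌊ c ≟ᶠ j ⌋) ≡ 2
#-pair {a = a} {c} a≢c = trans (#-∨ _ _ disjoint) (cong₂ _+_ (#-single a) (#-single c))
  where
  disjoint : ∀ j → T ⌊ a ≟ᶠ j ⌋ → ¬ T ⌊ c ≟ᶠ j ⌋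
  disjoint j a≡j c≡j = a≢c (trans (toWitness a≡j) (≡.sym (toWitness c≡j)))

#-remove : ∀ {m} (P : Fin m → Bool) (w : Fin m) → T (P w) →
           suc (# (λ u → P u ∧ not ⌊ w ≟ᶠ u ⌋)) ≡ # P
#-remove P w Pw = begin
  suc rest                                  ≡⟨ cong (_+ rest) (≡.sym (#-single w)) ⟩
  # (λ u → ⌊ w ≟ᶠ u ⌋) + rest               ≡⟨ cong (_+ rest) (#-cong _ _ to from) ⟩
  # (λ u → P u ∧ ⌊ w ≟ᶠ u ⌋) + rest         ≡⟨ ≡.sym (#-partition P _) ⟩
  # P                                       ∎
  where
  rest = # (λ u → P u ∧ not ⌊ w ≟ᶠ u ⌋)
  open ≡-Reasoning
  to : ∀ u → T ⌊ w ≟ᶠ u ⌋ → T (P u ∧ ⌊ w ≟ᶠ u ⌋)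
  to u t = ∧-intro (subst (T ∘ P) (toWitness t) Pw) t
  from : ∀ u → T (P u ∧ ⌊ w ≟ᶠ u ⌋) → T ⌊ w ≟ᶠ u ⌋
  from u = ∧-elimʳ {P u}

#-++ : ∀ m {n} (P : Fin (m + n) → Bool) → # P ≡ # (λ i → P (i ↑ˡ n)) + # (λ j → P (m ↑ʳ j))
#-++ zero    P = refl
#-++ (suc m) P with P zero
... | true  = cong suc (#-++ m (P ∘ suc))
... | false = #-++ m (P ∘ suc)

#-const : ∀ m b c → # {m} (λ _ → b) + m * c ≡ m * (if b then suc c else c)
#-const m true  c = trans (cong (_+ m * c) (#-true m)) (≡.sym (*-suc m c))
  where
  #-true : ∀ m → # {m} (λ _ → true) ≡ m
  #-true zero    = refl
  #-true (suc m) = cong suc (#-true m)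
#-const m false c = cong (_+ m * c) (#-false m)
  where
  #-false : ∀ m → # {m} (λ _ → false) ≡ 0
  #-false zero    = refl
  #-false (suc m) = #-false m

quotient-↑ˡ : ∀ {N} s (i : Fin s) → quotient {suc N} s (i ↑ˡ N * s) ≡ zero
quotient-↑ˡ {N} s i rewrite splitAt-↑ˡ s i (N * s) = refl

quotient-↑ʳ : ∀ {N} s (j : Fin (N * s)) → quotient {suc N} s (s ↑ʳ j) ≡ suc (quotient s j)
quotient-↑ʳ {N} s j rewrite splitAt-↑ʳ s (N * s) j = refl

#-quotient : ∀ {N} s (P : Fin N → Bool) → # (P ∘ quotient s) ≡ s * # P
#-quotient {zero}  s P = ≡.sym (*-zeroʳ s)
#-quotient {suc N} s P = begin
  # (P ∘ quotient s)
    ≡⟨ #-++ s (P ∘ quotient s) ⟩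
  # (λ i → P (quotient s (i ↑ˡ N * s))) + # (λ j → P (quotient s (s ↑ʳ j)))
    ≡⟨ cong₂ _+_ (#-ext (cong P ∘ quotient-↑ˡ s)) (#-ext (cong P ∘ quotient-↑ʳ s)) ⟩
  # {s} (λ _ → P zero) + # (λ j → P (suc (quotient s j)))
    ≡⟨ cong (# {s} (λ _ → P zero) +_) (#-quotient s (P ∘ suc)) ⟩
  # {s} (λ _ → P zero) + s * # (P ∘ suc)
    ≡⟨ #-const s (P zero) (# (P ∘ suc)) ⟩
  s * # P ∎
  where open ≡-Reasoning

one-of-three-≤-/3 : ∀ {x y z m} → x + y + z ≤ m → x ≤ m / 3 ⊎ y ≤ m / 3 ⊎ z ≤ m / 3
one-of-three-≤-/3 {x} {y} {z} {m} x+y+z≤m with x ≤? m / 3 | y ≤? m / 3 | z ≤? m / 3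
... | yes x≤ | _      | _      = inj₁ x≤
... | no _   | yes y≤ | _      = inj₂ (inj₁ y≤)
... | no _   | no _   | yes z≤ = inj₂ (inj₂ z≤)
... | no x≰  | no y≰  | no z≰  = contradiction t<t (<-irrefl refl)
  where
  t = m / 3
  3t+3≤m : suc t * 3 ≤ m
  3t+3≤m = begin
    suc t * 3                     ≡⟨ *-comm (suc t) 3 ⟩
    suc t + (suc t + (suc t + 0))
      ≤⟨ +-mono-≤ (≰⇒> x≰) (+-mono-≤ (≰⇒> y≰) (+-monoˡ-≤ 0 (≰⇒> z≰))) ⟩
    x + (y + (z + 0))             ≡⟨ cong (λ w → x + (y + w)) (+-identityʳ z) ⟩
    x + (y + z)                   ≡⟨ ≡.sym (+-assoc x y z) ⟩
    x + y + z                     ≤⟨ x+y+z≤m ⟩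
    m                             ∎
    where open ≤-Reasoning
  t<t : t < t
  t<t = ≤-trans (≤-reflexive (≡.sym (m*n/n≡m (suc t) 3))) (/-monoˡ-≤ 3 3t+3≤m)

<d+d⇒≤2*d∸1 : ∀ {m d} → m < d + d → m ≤ 2 * d ∸ 1
<d+d⇒≤2*d∸1 {m} {d} m<2d = subst (m ≤_) (pred[m∸n]≡m∸[1+n] (2 * d) 0)
  (suc[m]≤n⇒m≤pred[n] (subst (m <_) (cong (d +_) (≡.sym (+-identityʳ d))) m<2d))

[2[2+3k]∸1]/3≡1+2k : ∀ k → (2 * (2 + k * 3) ∸ 1) / 3 ≡ suc (k * 2)
[2[2+3k]∸1]/3≡1+2k k = trans (cong (λ m → (m ∸ 1) / 3) (2d≡ k)) (m*n/n≡m (suc (k * 2)) 3)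
  where
  2d≡ : ∀ k → 2 * (2 + k * 3) ≡ suc (suc (k * 2) * 3)
  2d≡ = solve-∀

-- Distances and balls

foldr-⊓-≤ : ∀ e {x xs} → x ∈ xs → foldr _⊓_ e xs ≤ x
foldr-⊓-≤ e (here refl) = m⊓n≤m _ _
foldr-⊓-≤ e (there x∈) = ≤-trans (m⊓n≤n _ _) (foldr-⊓-≤ e x∈)

module Distance (G : Graph) where

  infix 4 _∼_

  _∼_ : Fin′ G → Fin′ G → Set
  x ∼ y = T (adj G x y)

  ∼-sym : ∀ {x y} → x ∼ y → y ∼ x
  ∼-sym {x} {y} = subst T (sym G x y)

  ∼-irrefl : ∀ {x} → ¬ x ∼ x
  ∼-irrefl {x} x∼x = subst T (irrefl G x) x∼x

  DistLe-zero⁻ : ∀ {v w} → DistLe G v w 0 → v ≡ w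
  DistLe-zero⁻ = toWitness

  DistLe-suc : ∀ {v w} r → DistLe G v w r → DistLe G v w (suc r)
  DistLe-suc {v} {w} r = ∨-introˡ {inBall G v r w}

  DistLe-step : ∀ {v p w} r → DistLe G v p r → p ∼ w → DistLe G v w (suc r)
  DistLe-step {v} {p} {w} r vp p∼w =
    ∨-introʳ {inBall G v r w} (any⁺ _ (lose (∈-allFin p) (∧-intro {inBall G v r p} vp p∼w)))

  DistLe-suc⁻ : ∀ {v w} r → DistLe G v w (suc r) →
                DistLe G v w r ⊎ ∃[ p ] DistLe G v p r × p ∼ w
  DistLe-suc⁻ {v} {w} r h with ∨-elim {inBall G v r w} h
  ... | inj₁ vw = inj₁ vw
  ... | inj₂ t with satisfied (any⁻ _ (allFin (n G)) t)
  ...   | p , vp∧p∼w =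
    inj₂ (p , ∧-elimˡ {inBall G v r p} vp∧p∼w , ∧-elimʳ {inBall G v r p} vp∧p∼w)

  DistLe-refl : ∀ {v} r → DistLe G v v r
  DistLe-refl zero    = fromWitness refl
  DistLe-refl (suc r) = DistLe-suc r (DistLe-refl r)

  DistLe-trans : ∀ {u x y} a b → DistLe G u x a → DistLe G x y b → DistLe G u y (a + b)
  DistLe-trans a zero ux xy rewrite +-identityʳ a | DistLe-zero⁻ xy = ux
  DistLe-trans a (suc b) ux xy rewrite +-suc a b with DistLe-suc⁻ b xy
  ... | inj₁ xy′             = DistLe-suc (a + b) (DistLe-trans a b ux xy′)
  ... | inj₂ (p , xp , p∼y) = DistLe-step (a + b) (DistLe-trans a b ux xp) p∼y

  ∼⇒DistLe-one : ∀ {v w} → v ∼ w → DistLe G v w 1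
  ∼⇒DistLe-one = DistLe-step 0 (DistLe-refl 0)

  DistLe-suc-split : ∀ {v w} r → DistLe G v w (suc r) → ∃[ p ] DistLe G v p r × DistLe G p w 1
  DistLe-suc-split r vw with DistLe-suc⁻ r vw
  ... | inj₁ vw′             = _ , vw′ , DistLe-refl 1
  ... | inj₂ (p , vp , p∼w) = p , vp , ∼⇒DistLe-one p∼w

  DistLe-one⁻ : ∀ {v w} → DistLe G v w 1 → v ≡ w ⊎ v ∼ w
  DistLe-one⁻ h with DistLe-suc⁻ 0 h
  ... | inj₁ vw               = inj₁ (DistLe-zero⁻ vw)
  ... | inj₂ (p , vp , p∼w) rewrite DistLe-zero⁻ vp = inj₂ p∼w

  DistLe-extend : ∀ {v p w} r → DistLe G v p r → DistLe G p w 1 → DistLe G v w (suc r)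
  DistLe-extend r vp pw with DistLe-one⁻ pw
  ... | inj₁ refl = DistLe-suc r vp
  ... | inj₂ p∼w  = DistLe-step r vp p∼w

  DistLe-sym : ∀ {u v} r → DistLe G u v r → DistLe G v u r
  DistLe-sym zero uv rewrite DistLe-zero⁻ uv = DistLe-refl 0
  DistLe-sym (suc r) uv with DistLe-suc⁻ r uv
  ... | inj₁ uv′             = DistLe-suc r (DistLe-sym r uv′)
  ... | inj₂ (p , up , p∼v) = DistLe-trans 1 r (∼⇒DistLe-one (∼-sym p∼v)) (DistLe-sym r up)

  lipschitz-bound : (f : Fin′ G → ℕ) → (∀ {x y} → x ∼ y → f y ≤ suc (f x)) →
                    ∀ {v w} r → DistLe G v w r → f w ≤ r + f v
  lipschitz-bound f lip zero vw rewrite DistLe-zero⁻ vw = ≤-refl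
  lipschitz-bound f lip (suc r) vw with DistLe-suc⁻ r vw
  ... | inj₁ vw′             = m≤n⇒m≤1+n (lipschitz-bound f lip r vw′)
  ... | inj₂ (p , vp , p∼w) = ≤-trans (lip p∼w) (s≤s (lipschitz-bound f lip r vp))

  δBall≤degBall : ∀ {v w} r → DistLe G v w r → δBall G v r ≤ degBall G v r w
  δBall≤degBall {v} {w} r vw =
    foldr-⊓-≤ _ (∈-map⁺ (degBall G v r) (∈-filter⁺ (T? ∘ inBall G v r) (∈-allFin w) vw))

  ≤δBall : ∀ {v} r {c} → (∀ {w} → DistLe G v w r → c ≤ degBall G v r w) → c ≤ δBall G v r
  ≤δBall {v} r {c} lower =
    foldr-preservesᵇ {P = c ≤_} ⊓-glb (lower (DistLe-refl r))
      (All.map⁺ (All.map lower (All.all-filter (T? ∘ inBall G v r) (allFin (n G)))))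

  degBall≡# : ∀ v r w → degBall G v r w ≡ # (λ y → adj G w y ∧ inBall G v r y)
  degBall≡# v r w = count≡# (λ y → adj G w y ∧ inBall G v r y)

-- The upper bound

module _ (G : Graph) where
  open Distance G

  -- Walking back from x towards u, the first vertex inside B₂(u) comes right after one at distance 3.
  path-to-distance-three : ∀ {u x} r → DistLe G u x r → ¬ DistLe G u x 2 →
    ∃[ a ] ∃[ b ] ∃[ v ] u ∼ a × a ∼ b × b ∼ v × ¬ DistLe G u v 2
  path-to-distance-three zero ux x∉B₂ = ⊥-elim (x∉B₂ (DistLe-suc 1 (DistLe-suc 0 ux)))
  path-to-distance-three (suc r) ux x∉B₂ with DistLe-suc⁻ r ux
  ... | inj₁ ux′ = path-to-distance-three r ux′ x∉B₂
  ... | inj₂ (p , up , p∼x) with T? (inBall G _ 2 p)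
  ...   | no p∉B₂  = path-to-distance-three r up p∉B₂
  ...   | yes p∈B₂ with DistLe-suc⁻ 1 p∈B₂
  ...     | inj₁ p∈B₁ = ⊥-elim (x∉B₂ (DistLe-step 1 p∈B₁ p∼x))
  ...     | inj₂ (a , ua , a∼p) with DistLe-one⁻ ua
  ...       | inj₁ refl = ⊥-elim (x∉B₂ (DistLe-step 1 (∼⇒DistLe-one a∼p) p∼x))
  ...       | inj₂ u∼a = a , p , _ , u∼a , a∼p , p∼x , x∉B₂

  closed-neighbourhoods-disjoint : ∀ {u v y} → ¬ DistLe G u v 2 → DistLe G u y 1 → ¬ DistLe G v y 1
  closed-neighbourhoods-disjoint u∉B₂ uy vy = u∉B₂ (DistLe-trans 1 1 uy (DistLe-sym 1 vy))

  module _ {d} (regular : Regular G d) where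

    degree-split : ∀ x (Q : Fin′ G → Bool) →
                   d ≡ # (λ y → adj G x y ∧ Q y) + # (λ y → adj G x y ∧ not (Q y))
    degree-split x Q = trans (≡.sym (regular x)) (trans (count≡# (adj G x)) (#-partition (adj G x) Q))

    δBall₁≤ : ∀ {x w} → x ∼ w → δBall G x 1 ≤ # (λ y → adj G w y ∧ inBall G x 1 y)
    δBall₁≤ {x} {w} x∼w =
      ≤-trans (δBall≤degBall 1 (∼⇒DistLe-one x∼w)) (≤-reflexive (degBall≡# x 1 w))

    three-balls-bound : ∀ {u a b v} → u ∼ a → a ∼ b → b ∼ v → ¬ DistLe G u v 2 →
                        suc (δBall G a 1 + δBall G v 1 + δBall G u 1) ≤ d + d
    three-balls-bound {u} {a} {b} {v} u∼a a∼b b∼v u∉B₂ = begin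
      suc (δBall G a 1 + δBall G v 1 + δBall G u 1)
        ≤⟨ s≤s (+-mono-≤ (+-mono-≤ δa≤ (δBall₁≤ (∼-sym b∼v))) (δBall₁≤ u∼a)) ⟩
      suc (# X + # (b ∖ v) + # (b ∩ v) + # (a ∩ u))
        ≡⟨ rearrange (# X) (# (b ∖ v)) (# (b ∩ v)) (# (a ∩ u)) ⟩
      (# (b ∩ v) + # (b ∖ v)) + (# (a ∩ u) + suc (# X))
        ≤⟨ +-monoʳ-≤ (# (b ∩ v) + # (b ∖ v)) (+-monoʳ-≤ (# (a ∩ u)) X<a∖u) ⟩
      (# (b ∩ v) + # (b ∖ v)) + (# (a ∩ u) + # (a ∖ u))
        ≡⟨ ≡.sym (cong₂ _+_ (degree-split b (B₁ v)) (degree-split a (B₁ u))) ⟩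
      d + d ∎
      where
      open ≤-Reasoning
      B₁ : Fin′ G → Fin′ G → Bool
      B₁ x = inBall G x 1
      _∩_ _∖_ : Fin′ G → Fin′ G → Fin′ G → Bool
      (x ∩ z) y = adj G x y ∧ B₁ z y
      (x ∖ z) y = adj G x y ∧ not (B₁ z y)
      X : Fin′ G → Bool
      X y = (b ∩ a) y ∧ B₁ v y
      rearrange : ∀ x p q r → suc (x + p + q + r) ≡ (q + p) + (r + suc x)
      rearrange = solve-∀
      δa≤ : δBall G a 1 ≤ # X + # (b ∖ v)
      δa≤ = begin
        δBall G a 1                                          ≤⟨ δBall₁≤ a∼b ⟩
        # (b ∩ a)                                            ≡⟨ #-partition (b ∩ a) (B₁ v) ⟩
        # X + # (λ y → (b ∩ a) y ∧ not (B₁ v y))            ≤⟨ +-monoʳ-≤ (# X) (#-mono _ _ forget-a) ⟩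
        # X + # (b ∖ v)                                       ∎
        where
        forget-a : ∀ y → T ((b ∩ a) y ∧ not (B₁ v y)) → T ((b ∖ v) y)
        forget-a y t = ∧-intro (∧-elimˡ {adj G b y} (∧-elimˡ {(b ∩ a) y} t)) (∧-elimʳ {(b ∩ a) y} t)
      X⊆a∖u∖b : ∀ y → T (X y) → T ((a ∖ u) y ∧ not ⌊ b ≟ᶠ y ⌋)
      X⊆a∖u∖b y t with DistLe-one⁻ (∧-elimʳ {adj G b y} (∧-elimˡ {(b ∩ a) y} t))
      ... | inj₁ refl = ⊥-elim (closed-neighbourhoods-disjoint u∉B₂ (∼⇒DistLe-one u∼a) v∈B₁)
        where v∈B₁ = ∧-elimʳ {(b ∩ a) y} t
      ... | inj₂ a∼y = ∧-intro (∧-intro a∼y y∉B₁u) (not-intro (∼-irrefl ∘ b∼b))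
        where
        b∼y = ∧-elimˡ {adj G b y} (∧-elimˡ {(b ∩ a) y} t)
        y∉B₁u = not-intro λ uy → closed-neighbourhoods-disjoint u∉B₂ uy (∧-elimʳ {(b ∩ a) y} t)
        b∼b : T ⌊ b ≟ᶠ y ⌋ → b ∼ b
        b∼b b≡y = subst (b ∼_) (≡.sym (toWitness b≡y)) b∼y
      b∈a∖u : T ((a ∖ u) b)
      b∈a∖u = ∧-intro a∼b (not-intro λ ub → closed-neighbourhoods-disjoint u∉B₂ ub (∼⇒DistLe-one (∼-sym b∼v)))
      X<a∖u : suc (# X) ≤ # (a ∖ u)
      X<a∖u = ≤-trans (s≤s (#-mono _ _ X⊆a∖u∖b)) (≤-reflexive (#-remove (a ∖ u) b b∈a∖u))

∃δBall≤[2d∸1]/3 : ∀ (G : Graph) (d : ℕ) → Connected G → Regular G d → DiamAtLeast G 3 →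
  Σ (Fin′ G) λ v → Σ ℕ λ r → (1 ≤ r) × (δBall G v r ≤ (2 * d ∸ 1) / 3)
∃δBall≤[2d∸1]/3 G d connected regular (u , x , x∉B₂) with connected u x
... | r , ux with path-to-distance-three G r ux x∉B₂
... | a , b , v , u∼a , a∼b , b∼v , v∉B₂
  with one-of-three-≤-/3 (<d+d⇒≤2*d∸1 {d = d} (three-balls-bound G regular u∼a a∼b b∼v v∉B₂))
... | inj₁ δa≤        = a , 1 , ≤-refl , δa≤
... | inj₂ (inj₁ δv≤) = v , 1 , ≤-refl , δv≤
... | inj₂ (inj₂ δu≤) = u , 1 , ≤-refl , δu≤

-- The lexicographic product of a base graph with K_{k+1}: vertex x lies in group π x, and
-- distinct vertices are adjacent iff their groups are equal or adjacent.  R is the closed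
-- (reflexive) adjacency of the base graph.
module BlowUp {N : ℕ} (k : ℕ) (R : Fin N → Fin N → Bool)
              (R-refl : ∀ a → T (R a a)) (R-sym : ∀ a b → R a b ≡ R b a) where

  π : Fin (N * suc k) → Fin N
  π = quotient (suc k)

  blowUp : Graph
  blowUp = record
    { n      = N * suc k
    ; adj    = λ x y → not ⌊ x ≟ᶠ y ⌋ ∧ R (π x) (π y)
    ; sym    = λ x y → cong₂ (λ b c → not b ∧ c) (≟ᶠ-sym x y) (R-sym (π x) (π y))
    ; irrefl = λ x → cong (λ b → not b ∧ R (π x) (π x)) (≟ᶠ-refl x)
    }

  open Distance blowUp

  in-group : Fin N → Fin (N * suc k)
  in-group a = combine a zero

  π-in-group : ∀ a → π (in-group a) ≡ a
  π-in-group a = cong proj₁ (remQuot-combine a zero)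

  ∼-intro : ∀ {x y} → x ≢ y → T (R (π x) (π y)) → x ∼ y
  ∼-intro x≢y Rxy = ∧-intro (not-intro (x≢y ∘ toWitness)) Rxy

  ∼-R : ∀ {x y} → x ∼ y → T (R (π x) (π y))
  ∼-R {x} = ∧-elimʳ {not ⌊ x ≟ᶠ _ ⌋}

  R⇒DistLe-one : ∀ x y → T (R (π x) (π y)) → DistLe blowUp x y 1
  R⇒DistLe-one x y Rxy = by-cases (x ≟ᶠ y)
    where
    by-cases : Dec (x ≡ y) → DistLe blowUp x y 1
    by-cases (yes refl) = DistLe-refl 1
    by-cases (no x≢y)   = ∼⇒DistLe-one (∼-intro x≢y Rxy)

  DistLe-one⇒R : ∀ {x y} → DistLe blowUp x y 1 → T (R (π x) (π y))
  DistLe-one⇒R xy with DistLe-one⁻ xy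
  ... | inj₁ refl = R-refl _
  ... | inj₂ x∼y  = ∼-R x∼y

  #-others : (P : Fin N → Bool) (w : Fin (N * suc k)) → T (P (π w)) →
             suc (# (λ y → P (π y) ∧ not ⌊ w ≟ᶠ y ⌋)) ≡ suc k * # P
  #-others P w Pw = trans (#-remove (P ∘ π) w Pw) (#-quotient (suc k) P)

  suc-deg : ∀ w → suc (deg blowUp w) ≡ suc k * # (R (π w))
  suc-deg w = begin
    suc (count (adj blowUp w))                             ≡⟨ cong suc (count≡# (adj blowUp w)) ⟩
    suc (# (λ y → not ⌊ w ≟ᶠ y ⌋ ∧ R (π w) (π y)))        ≡⟨ cong suc (#-ext λ y → ∧-comm (not ⌊ w ≟ᶠ y ⌋) _) ⟩
    suc (# (λ y → R (π w) (π y) ∧ not ⌊ w ≟ᶠ y ⌋))        ≡⟨ #-others (R (π w)) w (R-refl (π w)) ⟩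
    suc k * # (R (π w))                                    ∎
    where open ≡-Reasoning

  Pair : Fin N → Fin N → Fin N → Bool
  Pair a c j = ⌊ a ≟ᶠ j ⌋ ∨ ⌊ c ≟ᶠ j ⌋

  Pair-elim : ∀ {a c j} → T (Pair a c j) → a ≡ j ⊎ c ≡ j
  Pair-elim {a} {c} {j} t with ∨-elim {⌊ a ≟ᶠ j ⌋} t
  ... | inj₁ a≡j = inj₁ (toWitness a≡j)
  ... | inj₂ c≡j = inj₂ (toWitness c≡j)

  Pair-intro : ∀ {a c j} → a ≡ j ⊎ c ≡ j → T (Pair a c j)
  Pair-intro {a} (inj₁ a≡j) = ∨-introˡ {⌊ a ≟ᶠ _ ⌋} (fromWitness a≡j)
  Pair-intro {a} (inj₂ c≡j) = ∨-introʳ {⌊ a ≟ᶠ _ ⌋} (fromWitness c≡j)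

  #-two-groups : ∀ w {c} → π w ≢ c → # (λ y → Pair (π w) c (π y) ∧ not ⌊ w ≟ᶠ y ⌋) ≡ suc (k * 2)
  #-two-groups w {c} w≢c = suc-injective (begin
    suc (# (λ y → Pair (π w) c (π y) ∧ not ⌊ w ≟ᶠ y ⌋)) ≡⟨ #-others (Pair (π w) c) w (Pair-intro {π w} {c} (inj₁ refl)) ⟩
    suc k * # (Pair (π w) c)                              ≡⟨ cong (suc k *_) (#-pair w≢c) ⟩
    suc k * 2                                             ∎)
    where open ≡-Reasoning

  module _ (no-isolated : ∀ a → ∃[ c ] a ≢ c × T (R a c)) where

    common-neighbour : ∀ a b → T (R b a) → ∃[ c ] a ≢ c × T (R a c) × T (R b c)
    common-neighbour a b Rba with a ≟ᶠ b
    ... | yes refl = let c , a≢c , Rac = no-isolated a in c , a≢c , Rac , Rac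
    ... | no  a≢b  = b , a≢b , subst T (R-sym b a) Rba , R-refl b

    degBall-lower : ∀ {v w} r → DistLe blowUp v w (suc r) → suc (k * 2) ≤ degBall blowUp v (suc r) w
    degBall-lower {v} {w} r vw with DistLe-suc-split r vw
    ... | p , vp , pw with common-neighbour (π w) (π p) (DistLe-one⇒R pw)
    ... | c , w≢c , Rwc , Rpc = begin
      suc (k * 2)                                               ≡⟨ ≡.sym (#-two-groups w w≢c) ⟩
      # (λ y → Pair (π w) c (π y) ∧ not ⌊ w ≟ᶠ y ⌋)             ≤⟨ #-mono _ _ into-ball ⟩
      # (λ y → adj blowUp w y ∧ inBall blowUp v (suc r) y)      ≡⟨ ≡.sym (degBall≡# v (suc r) w) ⟩
      degBall blowUp v (suc r) w                                ∎
      where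
      open ≤-Reasoning
      into-ball : ∀ y → T (Pair (π w) c (π y) ∧ not ⌊ w ≟ᶠ y ⌋) →
                  T (adj blowUp w y ∧ inBall blowUp v (suc r) y)
      into-ball y t = ∧-intro (∧-intro w≢y Rwy) (DistLe-extend r vp (R⇒DistLe-one p y Rpy))
        where
        w≢y = ∧-elimʳ {Pair (π w) c (π y)} t
        Rwy : T (R (π w) (π y))
        Rwy with Pair-elim {π w} {c} {π y} (∧-elimˡ {Pair (π w) c (π y)} t)
        ... | inj₁ w≡y = subst (T ∘ R (π w)) w≡y (R-refl (π w))
        ... | inj₂ c≡y = subst (T ∘ R (π w)) c≡y Rwc
        Rpy : T (R (π p) (π y))
        Rpy with Pair-elim {π w} {c} {π y} (∧-elimˡ {Pair (π w) c (π y)} t)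
        ... | inj₁ w≡y = subst (T ∘ R (π p)) w≡y (DistLe-one⇒R pw)
        ... | inj₂ c≡y = subst (T ∘ R (π p)) c≡y Rpc

    δBall-lower : ∀ v r → 1 ≤ r → suc (k * 2) ≤ δBall blowUp v r
    δBall-lower v (suc r) _ = ≤δBall (suc r) (degBall-lower r)

  δBall-upper : ∀ {v w} → π v ≢ π w → T (R (π v) (π w)) →
                (∀ g → T (R (π v) g) → T (R (π w) g) → π v ≡ g ⊎ π w ≡ g) →
                δBall blowUp v 1 ≤ suc (k * 2)
  δBall-upper {v} {w} v≢w Rvw only-two = begin
    δBall blowUp v 1                                        ≤⟨ δBall≤degBall 1 (R⇒DistLe-one v w Rvw) ⟩
    degBall blowUp v 1 w                                    ≡⟨ degBall≡# v 1 w ⟩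
    # (λ y → adj blowUp w y ∧ inBall blowUp v 1 y)          ≤⟨ #-mono _ _ into-groups ⟩
    # (λ y → Pair (π w) (π v) (π y) ∧ not ⌊ w ≟ᶠ y ⌋)       ≡⟨ #-two-groups w (v≢w ∘ ≡.sym) ⟩
    suc (k * 2)                                             ∎
    where
    open ≤-Reasoning
    into-groups : ∀ y → T (adj blowUp w y ∧ inBall blowUp v 1 y) →
                  T (Pair (π w) (π v) (π y) ∧ not ⌊ w ≟ᶠ y ⌋)
    into-groups y t =
      ∧-intro (Pair-intro (swap (only-two (π y) Rvy (∼-R w∼y)))) (∧-elimˡ {not ⌊ w ≟ᶠ y ⌋} w∼y)
      where
      w∼y = ∧-elimˡ {adj blowUp w y} t
      Rvy = DistLe-one⇒R (∧-elimʳ {adj blowUp w y} t)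

-- The extremal graphs

-- The cycle on 0, …, M; `near a b` says that b is at cyclic distance at most 1 from a.
module Cycle (M : ℕ) where

  next : ℕ → ℕ
  next a with a ≟ℕ M
  ... | yes _ = 0
  ... | no  _ = suc a

  prev : ℕ → ℕ
  prev zero    = M
  prev (suc a) = a

  next-M : next M ≡ 0
  next-M with M ≟ℕ M
  ... | yes _   = refl
  ... | no  M≢M = contradiction refl M≢M

  next-< : ∀ {a} → a < M → next a ≡ suc a
  next-< {a} a<M with a ≟ℕ M
  ... | yes refl = contradiction a<M (<-irrefl refl)
  ... | no  _    = refl

  next-cases : ∀ {a} → a ≤ M → (a ≡ M × next a ≡ 0) ⊎ (a < M × next a ≡ suc a)
  next-cases a≤M with m≤n⇒m<n∨m≡n a≤M
  ... | inj₁ a<M  = inj₂ (a<M , next-< a<M)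
  ... | inj₂ refl = inj₁ (refl , next-M)

  next-≤ : ∀ {a} → a ≤ M → next a ≤ M
  next-≤ a≤M with next-cases a≤M
  ... | inj₁ (_ , e)   rewrite e = z≤n
  ... | inj₂ (a<M , e) rewrite e = a<M

  prev-≤ : ∀ {a} → a ≤ M → prev a ≤ M
  prev-≤ {zero}  _   = ≤-refl
  prev-≤ {suc a} a<M = <⇒≤ a<M

  prev-next : ∀ {a} → a ≤ M → prev (next a) ≡ a
  prev-next a≤M with next-cases a≤M
  ... | inj₁ (a≡M , e) rewrite e = ≡.sym a≡M
  ... | inj₂ (_ , e)   rewrite e = refl

  next-prev : ∀ {a} → a ≤ M → next (prev a) ≡ a
  next-prev {zero}  _   = next-M
  next-prev {suc a} a<M = next-< a<M

  next≢ : 1 ≤ M → ∀ {a} → a ≤ M → next a ≢ a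
  next≢ 1≤M a≤M next≡a with next-cases a≤M
  ... | inj₁ (refl , e) = <⇒≢ 1≤M (trans (≡.sym e) next≡a)
  ... | inj₂ (_ , e)    = 1+n≢n (trans (≡.sym e) next≡a)

  prev≢ : 1 ≤ M → ∀ a → prev a ≢ a
  prev≢ 1≤M zero    = ≡.≢-sym (<⇒≢ 1≤M)
  prev≢ 1≤M (suc a) = ≡.≢-sym 1+n≢n

  next≢prev : 2 ≤ M → ∀ {a} → a ≤ M → next a ≢ prev a
  next≢prev 2≤M a≤M next≡prev with next-cases a≤M
  next≢prev 2≤M {a} _ next≡prev | inj₁ (a≡M , e) =
    <⇒≢ (prev-positive (≤-trans 2≤M (≤-reflexive (≡.sym a≡M)))) (trans (≡.sym e) next≡prev)
    where
    prev-positive : ∀ {a} → 2 ≤ a → 0 < prev a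
    prev-positive (s≤s (s≤s _)) = s≤s z≤n
  next≢prev 2≤M {zero}  _ next≡prev | inj₂ (_ , e) = <⇒≢ 2≤M (trans (≡.sym e) next≡prev)
  next≢prev 2≤M {suc a} _ next≡prev | inj₂ (_ , e) = <⇒≢ (s≤s (n≤1+n a)) (≡.sym (trans (≡.sym e) next≡prev))

  near : ℕ → ℕ → Bool
  near a b = (b ≡ᵇ a) ∨ ((b ≡ᵇ next a) ∨ (b ≡ᵇ prev a))

  near-elim : ∀ {a b} → T (near a b) → b ≡ a ⊎ b ≡ next a ⊎ b ≡ prev a
  near-elim {a} {b} t with ∨-elim {b ≡ᵇ a} t
  ... | inj₁ b≡a = inj₁ (≡ᵇ⇒≡ b a b≡a)
  ... | inj₂ t′ with ∨-elim {b ≡ᵇ next a} t′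
  ...   | inj₁ b≡next = inj₂ (inj₁ (≡ᵇ⇒≡ b (next a) b≡next))
  ...   | inj₂ b≡prev = inj₂ (inj₂ (≡ᵇ⇒≡ b (prev a) b≡prev))

  near-intro : ∀ {a b} → b ≡ a ⊎ b ≡ next a ⊎ b ≡ prev a → T (near a b)
  near-intro {a} {b} (inj₁ b≡a)           = ∨-introˡ {b ≡ᵇ a} (≡⇒≡ᵇ b a b≡a)
  near-intro {a} {b} (inj₂ (inj₁ b≡next)) = ∨-introʳ {b ≡ᵇ a} (∨-introˡ {b ≡ᵇ next a} (≡⇒≡ᵇ b (next a) b≡next))
  near-intro {a} {b} (inj₂ (inj₂ b≡prev)) = ∨-introʳ {b ≡ᵇ a} (∨-introʳ {b ≡ᵇ next a} (≡⇒≡ᵇ b (prev a) b≡prev))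

  near-refl : ∀ a → T (near a a)
  near-refl a = near-intro {a} {a} (inj₁ refl)

  near-next : ∀ a → T (near a (next a))
  near-next a = near-intro {a} {next a} (inj₂ (inj₁ refl))

  near-sym : ∀ {a b} → a ≤ M → T (near a b) → T (near b a)
  near-sym {a} {b} a≤M t with near-elim {a} {b} t
  ... | inj₁ refl        = t
  ... | inj₂ (inj₁ refl) = near-intro (inj₂ (inj₂ (≡.sym (prev-next a≤M))))
  ... | inj₂ (inj₂ refl) = near-intro (inj₂ (inj₁ (≡.sym (next-prev a≤M))))

  #-near : 2 ≤ M → ∀ {a} → a ≤ M → # (λ (j : Fin (suc M)) → near a (toℕ j)) ≡ 3
  #-near 2≤M {a} a≤M = begin
    # (λ j → E a j ∨ (E (next a) j ∨ E (prev a) j))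
      ≡⟨ #-∨ (E a) _ (λ j j≡a → [ next≢ 1≤M a≤M ∘ ≡.sym ∘ same j j≡a
                                , prev≢ 1≤M a ∘ ≡.sym ∘ same j j≡a ] ∘ ∨-elim {E (next a) j}) ⟩
    # (E a) + # (λ j → E (next a) j ∨ E (prev a) j)
      ≡⟨ cong (# (E a) +_) (#-∨ (E (next a)) (E (prev a)) λ j j≡next → next≢prev 2≤M a≤M ∘ same j j≡next) ⟩
    # (E a) + (# (E (next a)) + # (E (prev a)))
      ≡⟨ cong₂ _+_ (#-toℕ≡ a (s≤s a≤M))
                   (cong₂ _+_ (#-toℕ≡ (next a) (s≤s (next-≤ a≤M))) (#-toℕ≡ (prev a) (s≤s (prev-≤ a≤M)))) ⟩
    3 ∎
    where
    open ≡-Reasoning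
    1≤M = ≤-trans (s≤s z≤n) 2≤M
    E : ℕ → Fin (suc M) → Bool
    E c j = toℕ j ≡ᵇ c
    same : ∀ {c c′} j → T (E c j) → T (E c′ j) → c ≡ c′
    same {c} {c′} j j≡c j≡c′ = trans (≡.sym (≡ᵇ⇒≡ (toℕ j) c j≡c)) (≡ᵇ⇒≡ (toℕ j) c′ j≡c′)

  M≢-below-3 : 3 ≤ M → ∀ {c} → c < 3 → M ≢ c
  M≢-below-3 3≤M c<3 M≡c = <⇒≱ c<3 (≤-trans 3≤M (≤-reflexive M≡c))

  common-closed-neighbours-0-1 : 3 ≤ M → ∀ {g} → T (near 0 g) → T (near 1 g) → g ≡ 0 ⊎ g ≡ 1
  common-closed-neighbours-0-1 3≤M {g} g~0 g~1 with near-elim {0} {g} g~0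
  ... | inj₁ g≡0            = inj₁ g≡0
  ... | inj₂ (inj₁ g≡next0) = inj₂ (trans g≡next0 (next-< (≤-trans (s≤s z≤n) 3≤M)))
  ... | inj₂ (inj₂ refl)    with near-elim {1} {M} g~1
  ...   | inj₁ M≡1            = ⊥-elim (M≢-below-3 3≤M (s≤s (s≤s z≤n)) M≡1)
  ...   | inj₂ (inj₁ M≡next1) =
    ⊥-elim (M≢-below-3 3≤M ≤-refl (trans M≡next1 (next-< (≤-trans (s≤s (s≤s z≤n)) 3≤M))))
  ...   | inj₂ (inj₂ M≡0)     = ⊥-elim (M≢-below-3 3≤M (s≤s z≤n) M≡0)

  dist₀ : ℕ → ℕ
  dist₀ a = a ⊓ (suc M ∸ a)

  dist₀-next : ∀ {a} → a ≤ M → dist₀ (next a) ≤ suc (dist₀ a) × dist₀ a ≤ suc (dist₀ (next a))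
  dist₀-next a≤M with next-cases a≤M
  ... | inj₁ (refl , e) rewrite e = z≤n , ≤-trans (m⊓n≤n M (suc M ∸ M)) (≤-reflexive (m+n∸n≡m 1 M))
  ... | inj₂ (_ , e) rewrite e | +-∸-assoc 1 a≤M =
    ⊓-monoʳ-≤ (suc _) (m≤n⇒m≤1+n (n≤1+n _)) , ⊓-monoˡ-≤ (suc _) (m≤n⇒m≤1+n (n≤1+n _))

  dist₀-lipschitz : ∀ {a b} → a ≤ M → T (near a b) → dist₀ b ≤ suc (dist₀ a)
  dist₀-lipschitz {a} {b} a≤M a~b with near-elim {a} {b} a~b
  ... | inj₁ refl        = n≤1+n _
  ... | inj₂ (inj₁ refl) = proj₁ (dist₀-next a≤M)
  ... | inj₂ (inj₂ refl) =
    subst (λ c → dist₀ (prev a) ≤ suc (dist₀ c)) (next-prev a≤M) (proj₂ (dist₀-next (prev-≤ a≤M)))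

module CycleBlowUp (k M : ℕ) (3≤M : 3 ≤ M) where
  open Cycle M

  R : Fin (suc M) → Fin (suc M) → Bool
  R a b = near (toℕ a) (toℕ b)

  toℕ≤M : ∀ (a : Fin (suc M)) → toℕ a ≤ M
  toℕ≤M a = s≤s⁻¹ (toℕ<n a)

  open BlowUp k R (near-refl ∘ toℕ) (λ a b → T-extensional (near-sym (toℕ≤M a)) (near-sym (toℕ≤M b))) public
  open Distance blowUp

  2≤M : 2 ≤ M
  2≤M = ≤-trans (s≤s (s≤s z≤n)) 3≤M

  1≤M : 1 ≤ M
  1≤M = ≤-trans (s≤s z≤n) 2≤M

  group : Fin′ blowUp → ℕ
  group = toℕ ∘ π

  vertex : ∀ g → g ≤ M → Fin′ blowUp
  vertex g g≤M = in-group (fromℕ< (s≤s g≤M))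

  group-vertex : ∀ g (g≤M : g ≤ M) → group (vertex g g≤M) ≡ g
  group-vertex g g≤M = trans (cong toℕ (π-in-group _)) (toℕ-fromℕ< (s≤s g≤M))

  regular : Regular blowUp (2 + k * 3)
  regular w = suc-injective (trans (suc-deg w) (cong (suc k *_) (#-near 2≤M (toℕ≤M (π w)))))

  no-isolated : ∀ a → ∃[ c ] a ≢ c × T (R a c)
  no-isolated a = c , a≢c , subst (T ∘ near (toℕ a)) (≡.sym toℕc≡next) (near-next (toℕ a))
    where
    c = fromℕ< (s≤s (next-≤ (toℕ≤M a)))
    toℕc≡next : toℕ c ≡ next (toℕ a)
    toℕc≡next = toℕ-fromℕ< _
    a≢c : a ≢ c
    a≢c a≡c = next≢ 1≤M (toℕ≤M a) (trans (≡.sym toℕc≡next) (cong toℕ (≡.sym a≡c)))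

  root : Fin′ blowUp
  root = vertex 0 z≤n

  δBall-root≤ : δBall blowUp root 1 ≤ suc (k * 2)
  δBall-root≤ = δBall-upper {root} {w} root≢w root~w only-two
    where
    w = vertex 1 1≤M
    g₀ = group-vertex 0 z≤n
    g₁ = group-vertex 1 1≤M
    root≢w : π root ≢ π w
    root≢w e = 0≢1+n (trans (≡.sym g₀) (trans (cong toℕ e) g₁))
    root~w : T (R (π root) (π w))
    root~w = subst₂ (λ a b → T (near a b)) (≡.sym g₀) (≡.sym g₁) (near-intro (inj₂ (inj₁ (≡.sym (next-< 1≤M)))))
    only-two : ∀ g → T (R (π root) g) → T (R (π w) g) → π root ≡ g ⊎ π w ≡ g
    only-two g r0 r1
      with common-closed-neighbours-0-1 3≤M (subst (λ a → T (near a (toℕ g))) g₀ r0)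
                                             (subst (λ a → T (near a (toℕ g))) g₁ r1)
    ... | inj₁ g≡0 = inj₁ (toℕ-injective (trans g₀ (≡.sym g≡0)))
    ... | inj₂ g≡1 = inj₂ (toℕ-injective (trans g₁ (≡.sym g≡1)))

  reaches-root : ∀ g x → group x ≡ g → DistLe blowUp x root (suc g)
  reaches-root zero    x x∈0 = R⇒DistLe-one x root (near-intro (inj₁ (trans (group-vertex 0 z≤n) (≡.sym x∈0))))
  reaches-root (suc g) x x∈g+1 =
    DistLe-trans 1 (suc g) (R⇒DistLe-one x y x~y) (reaches-root g y (group-vertex g g≤M))
    where
    g≤M : g ≤ M
    g≤M = ≤-trans (n≤1+n g) (≤-trans (≤-reflexive (≡.sym x∈g+1)) (toℕ≤M (π x)))
    y = vertex g g≤M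
    x~y : T (R (π x) (π y))
    x~y = near-intro (inj₂ (inj₂ (trans (group-vertex g g≤M) (cong prev (≡.sym x∈g+1)))))

  connected : Connected blowUp
  connected x y = suc (group x) + suc (group y) ,
    DistLe-trans (suc (group x)) (suc (group y))
      (reaches-root (group x) x refl) (DistLe-sym (suc (group y)) (reaches-root (group y) y refl))

  antipode-far : ∀ D′ (D′<M : suc D′ ≤ M) → M ≡ D′ + suc D′ → ¬ DistLe blowUp root (vertex (suc D′) D′<M) D′
  antipode-far D′ D′<M M≡ root~far = 1+n≰n (begin
    suc D′                       ≡⟨ ≡.sym (⊓-idem (suc D′)) ⟩
    suc D′ ⊓ suc D′              ≡⟨ cong (suc D′ ⊓_) (≡.sym (trans (cong (_∸ D′) M≡) (m+n∸m≡n D′ (suc D′)))) ⟩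
    dist₀ (suc D′)               ≡⟨ cong dist₀ (≡.sym (group-vertex (suc D′) D′<M)) ⟩
    dist₀ (group far)            ≤⟨ lipschitz-bound (dist₀ ∘ group) (λ {x} {y} → lipschitz {x} {y}) D′ root~far ⟩
    D′ + dist₀ (group root)      ≡⟨ cong (λ a → D′ + dist₀ a) (group-vertex 0 z≤n) ⟩
    D′ + 0                       ≡⟨ +-identityʳ D′ ⟩
    D′                           ∎)
    where
    open ≤-Reasoning
    far = vertex (suc D′) D′<M
    lipschitz : ∀ {x y} → x ∼ y → dist₀ (group y) ≤ suc (dist₀ (group x))
    lipschitz {x} {y} x∼y = dist₀-lipschitz (toℕ≤M (π x)) (∼-R {x} {y} x∼y)

  δBall-≥ : ∀ v r → 1 ≤ r → suc (k * 2) ≤ δBall blowUp v r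
  δBall-≥ = δBall-lower no-isolated

[2d∸1]/3-attained : ∀ (d D : ℕ) → d % 3 ≡ 2 → 3 ≤ D →
  Σ Graph λ G → Connected G × Regular G d × DiamAtLeast G D ×
    (Σ (Fin′ G) λ v → Σ ℕ λ r → (1 ≤ r) × (δBall G v r ≡ (2 * d ∸ 1) / 3)) ×
    (∀ (v : Fin′ G) (r : ℕ) → 1 ≤ r → (2 * d ∸ 1) / 3 ≤ δBall G v r)
[2d∸1]/3-attained d (suc D′) d%3≡2 (s≤s 2≤D′) =
  blowUp , connected , (λ w → trans (regular w) (≡.sym d≡2+3k)) ,
  (root , vertex (suc D′) D′<M , antipode-far D′ D′<M refl) ,
  (root , 1 , ≤-refl , trans (≤-antisym δBall-root≤ (δBall-≥ root 1 ≤-refl)) (≡.sym threshold)) ,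
  λ v r 1≤r → subst (_≤ δBall blowUp v r) (≡.sym threshold) (δBall-≥ v r 1≤r)
  where
  k = d / 3
  d≡2+3k : d ≡ 2 + k * 3
  d≡2+3k = trans (m≡m%n+[m/n]*n d 3) (cong (_+ k * 3) d%3≡2)
  threshold : (2 * d ∸ 1) / 3 ≡ suc (k * 2)
  threshold = trans (cong (λ d → (2 * d ∸ 1) / 3) d≡2+3k) ([2[2+3k]∸1]/3≡1+2k k)
  D′<M : suc D′ ≤ D′ + suc D′
  D′<M = m≤n+m (suc D′) D′
  open CycleBlowUp k (D′ + suc D′) (≤-trans (s≤s 2≤D′) D′<M)

theorem4 :
    (∀ (G : Graph) (d : ℕ) → Connected G → Regular G d → DiamAtLeast G 3 →
      Σ (Fin′ G) λ v → Σ ℕ λ r → (1 ≤ r) × (δBall G v r ≤ (2 * d ∸ 1) / 3))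
    ×
    (∀ (d D : ℕ) → d % 3 ≡ 2 → 3 ≤ D →
      Σ Graph λ G → Connected G × Regular G d × DiamAtLeast G D ×
        (Σ (Fin′ G) λ v → Σ ℕ λ r → (1 ≤ r) × (δBall G v r ≡ (2 * d ∸ 1) / 3)) ×
        (∀ (v : Fin′ G) (r : ℕ) → 1 ≤ r → (2 * d ∸ 1) / 3 ≤ δBall G v r))
theorem4 = ∃δBall≤[2d∸1]/3 , [2d∸1]/3-attained
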